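{- Let $d$ be a positive integer and let $C$ be a configuration of pebbles on the $d$-dimensional hypercube $Q^d$ with $|C|\ge 3^d-|\sigma(C)|+1$. Then $C$ is coverable.
   Context: The $d$-dimensional hypercube $Q^d$ has vertex set $\{0,1\}^d$, two vertices being adjacent iff they differ in exactly one coordinate. A configuration of pebbles on $Q^d$ is a function $C:V(Q^d)\to\{0,1,2,\ldots\}$; its size is $|C|=\sum_{x}C(x)$ and its support is $\sigma(C)=\{x: C(x)>0\}$. A pebbling step removes two pebbles from one vertex and places one pebble on an adjacent vertex. $C$ is coverable if after some sequence of pebbling steps no vertex has zero pebbles. (The paper calls configurations satisfying the size hypothesis "good".) -}

module Defs where

open import Data.Nat using (ℕ; zero; suc; _+_; _∸_; _≤_; _<_)
open import Data.Bool using (Bool; true; false; if_then_else_)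
import Data.Bool as Bool
open import Data.Vec using (Vec; []; _∷_)
open import Data.Vec.Properties using (≡-dec)
open import Data.List using (List; []; _∷_; _++_; map; length; filter)
open import Data.Nat.ListAction using (sum)
open import Relation.Binary.PropositionalEquality using (_≡_)
open import Relation.Nullary using (¬_; does)
open import Relation.Nullary.Decidable using (¬?)
import Data.Nat as ℕ

Vertex : ℕ → Set
Vertex d = Vec Bool d

vertices : (d : ℕ) → List (Vertex d)
vertices zero = [] ∷ []
vertices (suc d) = map (false ∷_) (vertices d) ++ map (true ∷_) (vertices d)

hamming : {d : ℕ} → Vertex d → Vertex d → ℕ
hamming [] [] = 0
hamming (a ∷ x) (b ∷ y) = (if does (a Bool.≟ b) then 0 else 1) + hamming x y

Adjacent : {d : ℕ} → Vertex d → Vertex d → Set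
Adjacent x y = hamming x y ≡ 1

Config : ℕ → Set
Config d = Vertex d → ℕ

size : {d : ℕ} → Config d → ℕ
size {d} C = sum (map C (vertices d))

supportSize : {d : ℕ} → Config d → ℕ
supportSize {d} C = length (filter (λ x → ¬? (C x ℕ.≟ 0)) (vertices d))

_≟V_ : {d : ℕ} → (x y : Vertex d) → Relation.Nullary.Dec (x ≡ y)
_≟V_ = ≡-dec Bool._≟_

move : {d : ℕ} → Config d → Vertex d → Vertex d → Config d
move C u v w =
  if does (w ≟V u) then C u ∸ 2
  else if does (w ≟V v) then suc (C v)
  else C w

data Coverable {d : ℕ} : Config d → Set where
  covered : {C : Config d} → (∀ x → 0 < C x) → Coverable C
  step    : {C : Config d} (u v : Vertex d) → Adjacent u v → 2 ≤ C u →
            Coverable (move C u v) → Coverable C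

-- Give a vertex carrying n pebbles the weight n + [n > 0]; the hypothesis says that the total
-- weight exceeds 3^d, and this suffices by induction on d. Split Q^(d+1) into two copies of Q^d
-- joined by a perfect matching. If both halves weigh more than 3^d, cover each by induction.
-- Otherwise one (target) half weighs at most 3^d and the other (source) half more than 2·3^d;
-- push pebbles one at a time along matching edges until the target weighs more than 3^d. With w
-- the source weight and p, o the numbers of pebbles and occupied vertices of the target, well
-- chosen pushes never lower the potential w + 2p + o, which keeps the source heavier than 3^d.
module Submission where

open import Defs
open import Data.Nat using (ℕ; zero; suc; _+_; _*_; _∸_; _^_; _≤_; _<_; z≤n; s≤s; s≤s⁻¹; _≤?_; _≟_)
open import Data.Nat.Properties
open import Data.Nat.ListAction using (sum)
open import Data.Nat.ListAction.Properties using (sum-++)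
open import Data.Nat.Tactic.RingSolver using (solve-∀)
open import Algebra.Properties.CommutativeSemigroup +-commutativeSemigroup
  using (interchange; xy∙z≈xz∙y)
open import Data.Bool using (Bool; true; false; not; if_then_else_)
open import Data.List using ([]; _∷_; _++_; map; length; filter)
open import Data.List.Properties using (map-++; map-∘)
open import Data.Product using (∃; _×_; _,_; proj₁; proj₂)
open import Data.Sum using (_⊎_; inj₁; inj₂; [_,_]′)
open import Data.Vec using ([]; _∷_)
open import Function using (_∘_; id)
open import Relation.Binary.PropositionalEquality
open import Relation.Nullary using (¬_; Dec; yes; no; does; contradiction)
open import Relation.Nullary.Decidable using (¬?; _×-dec_; dec-true; dec-false)
open import Relation.Unary using (Decidable)

occupied : ℕ → ℕ
occupied zero    = 0
occupied (suc _) = 1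

weight : ℕ → ℕ
weight n = n + occupied n

occupied≤1 : ∀ n → occupied n ≤ 1
occupied≤1 zero    = z≤n
occupied≤1 (suc _) = ≤-refl

occupied≤id : ∀ n → occupied n ≤ n
occupied≤id zero    = z≤n
occupied≤id (suc _) = s≤s z≤n

weight-∸2 : ∀ {a} → 3 ≤ a → weight a ≡ 2 + weight (a ∸ 2)
weight-∸2 (s≤s (s≤s (s≤s _))) = refl

-- Sums over the vertices of a cube

∑ : ∀ {d} → (Vertex d → ℕ) → ℕ
∑ {zero}  h = h []
∑ {suc d} h = ∑ (h ∘ (false ∷_)) + ∑ (h ∘ (true ∷_))

∑-cong : ∀ {d} {h k : Vertex d → ℕ} → h ≗ k → ∑ h ≡ ∑ k
∑-cong {zero}  h≗k = h≗k []
∑-cong {suc d} h≗k = cong₂ _+_ (∑-cong (h≗k ∘ (false ∷_))) (∑-cong (h≗k ∘ (true ∷_)))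

∑-mono-≤ : ∀ {d} {h k : Vertex d → ℕ} → (∀ x → h x ≤ k x) → ∑ h ≤ ∑ k
∑-mono-≤ {zero}  h≤k = h≤k []
∑-mono-≤ {suc d} h≤k = +-mono-≤ (∑-mono-≤ (h≤k ∘ (false ∷_))) (∑-mono-≤ (h≤k ∘ (true ∷_)))

∑-distrib-+ : ∀ {d} (h k : Vertex d → ℕ) → ∑ (λ x → h x + k x) ≡ ∑ h + ∑ k
∑-distrib-+ {zero}  h k = refl
∑-distrib-+ {suc d} h k =
  trans (cong₂ _+_ (∑-distrib-+ (h ∘ (false ∷_)) (k ∘ (false ∷_)))
                   (∑-distrib-+ (h ∘ (true ∷_)) (k ∘ (true ∷_))))
        (interchange (∑ (h ∘ (false ∷_))) (∑ (k ∘ (false ∷_))) _ _)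

∑-const : ∀ d c → ∑ {d} (λ _ → c) ≡ c * 2 ^ d
∑-const zero    c = sym (*-identityʳ c)
∑-const (suc d) c = trans (cong₂ _+_ (∑-const d c) (∑-const d c)) (double c (2 ^ d))
  where
  double : ∀ c m → c * m + c * m ≡ c * (2 * m)
  double = solve-∀

term≤∑ : ∀ {d} (h : Vertex d → ℕ) x → h x ≤ ∑ h
term≤∑ {zero}  h []          = ≤-refl
term≤∑ {suc d} h (false ∷ x) = ≤-trans (term≤∑ _ x) (m≤m+n _ _)
term≤∑ {suc d} h (true ∷ x)  = ≤-trans (term≤∑ _ x) (m≤n+m _ _)

∑≡0⇒≡0 : ∀ {d} (h : Vertex d → ℕ) → ∑ h ≡ 0 → ∀ x → h x ≡ 0
∑≡0⇒≡0 h ∑h≡0 x = n≤0⇒n≡0 (subst (h x ≤_) ∑h≡0 (term≤∑ h x))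

_[_↦_] : ∀ {d} → (Vertex d → ℕ) → Vertex d → ℕ → Vertex d → ℕ
(h [ y ↦ n ]) x = if does (x ≟V y) then n else h x

update-≡ : ∀ {d} (h : Vertex d → ℕ) y n → (h [ y ↦ n ]) y ≡ n
update-≡ h y n = cong (λ b → if b then n else h y) (dec-true (y ≟V y) refl)

update-≢ : ∀ {d} (h : Vertex d → ℕ) {x y} n → ¬ x ≡ y → (h [ y ↦ n ]) x ≡ h x
update-≢ h {x} {y} n x≢y = cong (λ b → if b then n else h x) (dec-false (x ≟V y) x≢y)

-- On each half, an update is definitionally an update of that half or no change at all.
∑-update : ∀ {d} (f : ℕ → ℕ) (h : Vertex d → ℕ) y n →
  ∑ (f ∘ (h [ y ↦ n ])) + f (h y) ≡ ∑ (f ∘ h) + f n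
∑-update {zero}  f h [] n = +-comm (f n) (f (h []))
∑-update {suc d} f h (false ∷ y) n =
  trans (xy∙z≈xz∙y (∑ (f ∘ ((h ∘ (false ∷_)) [ y ↦ n ]))) (∑ (f ∘ h ∘ (true ∷_))) _)
    (trans (cong (_+ ∑ (f ∘ h ∘ (true ∷_))) (∑-update f (h ∘ (false ∷_)) y n))
           (xy∙z≈xz∙y (∑ (f ∘ h ∘ (false ∷_))) _ _))
∑-update {suc d} f h (true ∷ y) n =
  trans (+-assoc (∑ (f ∘ h ∘ (false ∷_))) _ _)
    (trans (cong (∑ (f ∘ h ∘ (false ∷_)) +_) (∑-update f (h ∘ (true ∷_)) y n))
           (sym (+-assoc (∑ (f ∘ h ∘ (false ∷_))) _ _)))

pebbleCount occupiedCount totalWeight : ∀ {d} → Config d → ℕ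
pebbleCount   C = ∑ C
occupiedCount C = ∑ (occupied ∘ C)
totalWeight   C = ∑ (weight ∘ C)

totalWeight≡pebbles+occupied : ∀ {d} (C : Config d) →
  totalWeight C ≡ pebbleCount C + occupiedCount C
totalWeight≡pebbles+occupied C = ∑-distrib-+ C (occupied ∘ C)

occupiedCount≤pebbleCount : ∀ {d} (C : Config d) → occupiedCount C ≤ pebbleCount C
occupiedCount≤pebbleCount C = ∑-mono-≤ (occupied≤id ∘ C)

occupiedCount≡0⇒pebbleCount≡0 : ∀ {d} (C : Config d) → occupiedCount C ≡ 0 → pebbleCount C ≡ 0
occupiedCount≡0⇒pebbleCount≡0 {d} C none =
  trans (∑-cong (λ x → unoccupied (C x) (∑≡0⇒≡0 (occupied ∘ C) none x))) (∑-const d 0)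
  where
  unoccupied : ∀ n → occupied n ≡ 0 → n ≡ 0
  unoccupied zero _ = refl

sum-vertices : ∀ d (h : Vertex d → ℕ) → sum (map h (vertices d)) ≡ ∑ h
sum-vertices zero    h = +-identityʳ (h [])
sum-vertices (suc d) h = begin
  sum (map h (map (false ∷_) vs ++ map (true ∷_) vs))
    ≡⟨ cong sum (map-++ h (map (false ∷_) vs) _) ⟩
  sum (map h (map (false ∷_) vs) ++ map h (map (true ∷_) vs))
    ≡⟨ sum-++ (map h (map (false ∷_) vs)) _ ⟩
  sum (map h (map (false ∷_) vs)) + sum (map h (map (true ∷_) vs))
    ≡⟨ cong₂ _+_ (half false) (half true) ⟩
  ∑ h ∎
  where
  open ≡-Reasoning
  vs = vertices d
  half : ∀ b → sum (map h (map (b ∷_) vs)) ≡ ∑ (h ∘ (b ∷_))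
  half b = trans (cong sum (sym (map-∘ vs))) (sum-vertices d (h ∘ (b ∷_)))

length-filter-nonzero : ∀ {A : Set} (C : A → ℕ) xs →
  length (filter (λ x → ¬? (C x ≟ 0)) xs) ≡ sum (map (occupied ∘ C) xs)
length-filter-nonzero C []       = refl
length-filter-nonzero C (x ∷ xs) with C x
... | zero  = length-filter-nonzero C xs
... | suc _ = cong suc (length-filter-nonzero C xs)

size+supportSize≡totalWeight : ∀ {d} (C : Config d) → size C + supportSize C ≡ totalWeight C
size+supportSize≡totalWeight {d} C = trans
  (cong₂ _+_ (sum-vertices d C)
             (trans (length-filter-nonzero C (vertices d)) (sum-vertices d (occupied ∘ C))))
  (sym (totalWeight≡pebbles+occupied C))

search : ∀ {d} (P : Vertex d → Set) → Decidable P → ∃ P ⊎ (∀ y → ¬ P y)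
search {zero} P P? with P? []
... | yes p  = inj₁ ([] , p)
... | no ¬p = inj₂ λ { [] → ¬p }
search {suc d} P P? with search (P ∘ (false ∷_)) (P? ∘ (false ∷_))
                       | search (P ∘ (true ∷_)) (P? ∘ (true ∷_))
... | inj₁ (y , p) | _            = inj₁ (false ∷ y , p)
... | inj₂ _       | inj₁ (y , p) = inj₁ (true ∷ y , p)
... | inj₂ none₀   | inj₂ none₁   = inj₂ λ { (false ∷ y) → none₀ y ; (true ∷ y) → none₁ y }

-- Covering a cube half by half

hamming-refl : ∀ {d} (x : Vertex d) → hamming x x ≡ 0
hamming-refl []          = refl
hamming-refl (false ∷ x) = hamming-refl x
hamming-refl (true ∷ x)  = hamming-refl x

adjacent-∷ : ∀ {d} b {u v : Vertex d} → Adjacent u v → Adjacent (b ∷ u) (b ∷ v)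
adjacent-∷ false adj = adj
adjacent-∷ true  adj = adj

adjacent-across : ∀ {d} b (y : Vertex d) → Adjacent (b ∷ y) (not b ∷ y)
adjacent-across false y = cong suc (hamming-refl y)
adjacent-across true  y = cong suc (hamming-refl y)

move-cong : ∀ {d} {C D : Config d} {u v} → C ≗ D → move C u v ≗ move D u v
move-cong {u = u} {v} C≗D w with does (w ≟V u) | does (w ≟V v)
... | true  | _     = cong (_∸ 2) (C≗D u)
... | false | true  = cong suc (C≗D v)
... | false | false = C≗D w

move-inside : ∀ {d} b (C : Config (suc d)) u v y →
  move C (b ∷ u) (b ∷ v) (b ∷ y) ≡ move (C ∘ (b ∷_)) u v y
move-inside false C u v y = refl
move-inside true  C u v y = refl

move-outside : ∀ {d} b (C : Config (suc d)) u v y →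
  move C (b ∷ u) (b ∷ v) (not b ∷ y) ≡ C (not b ∷ y)
move-outside false C u v y = refl
move-outside true  C u v y = refl

move-across-source : ∀ {d} b (C : Config (suc d)) y →
  move C (b ∷ y) (not b ∷ y) ∘ (b ∷_) ≗ (C ∘ (b ∷_)) [ y ↦ C (b ∷ y) ∸ 2 ]
move-across-source false C y x = refl
move-across-source true  C y x = refl

move-across-target : ∀ {d} b (C : Config (suc d)) y →
  move C (b ∷ y) (not b ∷ y) ∘ (not b ∷_) ≗ (C ∘ (not b ∷_)) [ y ↦ suc (C (not b ∷ y)) ]
move-across-target false C y x = refl
move-across-target true  C y x = refl

-- Replays a covering of half b inside the whole cube; the other half is never touched.
coverable-lift-half : ∀ {d} b {C : Config (suc d)} {D : Config d} → Coverable D → C ∘ (b ∷_) ≗ D →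
  (∀ C′ → (∀ y → 0 < C′ (b ∷ y)) → (∀ y → C′ (not b ∷ y) ≡ C (not b ∷ y)) → Coverable C′) →
  Coverable C
coverable-lift-half b (covered pos) C≗D k =
  k _ (λ y → subst (0 <_) (sym (C≗D y)) (pos y)) (λ _ → refl)
coverable-lift-half b {C} (step u v adj 2≤Du rest) C≗D k =
  step (b ∷ u) (b ∷ v) (adjacent-∷ b {u} {v} adj) (subst (2 ≤_) (sym (C≗D u)) 2≤Du)
    (coverable-lift-half b rest (λ y → trans (move-inside b C u v y) (move-cong C≗D y))
      (λ C′ pos same → k C′ pos (λ y → trans (same y) (move-outside b C u v y))))

coverable-from-halves : ∀ {d} b (C : Config (suc d)) →
  Coverable (C ∘ (b ∷_)) → Coverable (C ∘ (not b ∷_)) → Coverable C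
coverable-from-halves false C cov₀ cov₁ =
  coverable-lift-half false cov₀ (λ _ → refl) λ C′ pos₀ same₁ →
  coverable-lift-half true cov₁ same₁ λ C″ pos₁ same₀ →
  covered λ { (false ∷ y) → subst (0 <_) (sym (same₀ y)) (pos₀ y) ; (true ∷ y) → pos₁ y }
coverable-from-halves true C cov₁ cov₀ = coverable-from-halves false C cov₀ cov₁

-- Arithmetic of the potential

1≤3^d : ∀ d → 1 ≤ 3 ^ d
1≤3^d d = m^n>0 3 d

2^d≤3^d : ∀ d → 2 ^ d ≤ 3 ^ d
2^d≤3^d d = ^-monoˡ-≤ d (s≤s (s≤s z≤n))

2^[1+d]≤1+3^d : ∀ d → 2 * 2 ^ d ≤ suc (3 ^ d)
2^[1+d]≤1+3^d zero    = ≤-refl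
2^[1+d]≤1+3^d (suc d) = begin
  2 * (2 * 2 ^ d)        ≤⟨ *-monoʳ-≤ 2 (2^[1+d]≤1+3^d d) ⟩
  2 * suc (3 ^ d)        ≡⟨ twice (3 ^ d) ⟩
  suc (1 + 2 * 3 ^ d)    ≤⟨ s≤s (+-monoˡ-≤ (2 * 3 ^ d) (1≤3^d d)) ⟩
  suc (3 * 3 ^ d)        ∎
  where
  open ≤-Reasoning
  twice : ∀ m → 2 * suc m ≡ suc (1 + 2 * m)
  twice = solve-∀

3^d≢2 : ∀ d → ¬ 3 ^ d ≡ 2
3^d≢2 zero    ()
3^d≢2 (suc d) 3^[1+d]≡2 =
  <-irrefl refl (≤-trans (*-monoʳ-≤ 3 (1≤3^d d)) (≤-reflexive 3^[1+d]≡2))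

potential : ℕ → ℕ → ℕ → ℕ
potential w p o = w + (p + (p + o))

Charged : ℕ → ℕ → ℕ → ℕ → Set
Charged N w p o = occupied p + suc (3 * N) ≤ potential w p o

charged-weaken : ∀ {N w p o} → Charged N w p o → suc (3 * N) ≤ potential w p o
charged-weaken {p = p} charged = ≤-trans (m≤n+m _ (occupied p)) charged

charged-from-strong : ∀ {N w p o} → 2 + 3 * N ≤ potential w p o → Charged N w p o
charged-from-strong {p = p} strong = ≤-trans (+-monoˡ-≤ _ (occupied≤1 p)) strong

potential-raise : ∀ N w p o → suc (3 * N) ≤ w + (p + o) → p + suc (3 * N) ≤ potential w p o
potential-raise N w p o h =
  subst (p + suc (3 * N) ≤_) (rearrange w p o) (+-monoʳ-≤ p h)
  where
  rearrange : ∀ w p o → p + (w + (p + o)) ≡ w + (p + (p + o))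
  rearrange = solve-∀

initially-charged : ∀ {N w p o} → suc (3 * N) ≤ w + (p + o) →
  Charged N w p o × (3 + 3 * N ≤ potential w p o ⊎ p ≤ 1)
initially-charged {N} {w} {zero}        {o} h = h , inj₂ z≤n
initially-charged {N} {w} {suc zero}    {o} h = potential-raise N w 1 o h , inj₂ ≤-refl
initially-charged {N} {w} {suc (suc k)} {o} h = ≤-trans (n≤1+n _) three , inj₁ three
  where
  three : 3 + 3 * N ≤ potential w (2 + k) o
  three = ≤-trans (s≤s (s≤s (m≤n+m (suc (3 * N)) k))) (potential-raise N w (2 + k) o h)

≤-from-budget : ∀ {a N w x y} → a + (N + N) ≤ w + (x + y) → x ≤ N → y ≤ N → a ≤ w
≤-from-budget {a} {N} {w} h x≤N y≤N =
  +-cancelʳ-≤ (N + N) a w (≤-trans h (+-monoʳ-≤ w (+-mono-≤ x≤N y≤N)))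

charge⇒w≥3+N : ∀ {N w p o} → 1 ≤ N → o ≤ p → (o ≡ 0 → p ≡ 0) → p + o ≤ N →
  Charged N w p o → 3 + N ≤ w
charge⇒w≥3+N {N} {w} {zero}  {zero}  1≤N _ _ _ charged =
  ≤-trans (3+N≤1+3N 1≤N) (subst (suc (3 * N) ≤_) (+-identityʳ w) charged)
  where
  3+N≤1+3N : ∀ {N} → 1 ≤ N → 3 + N ≤ suc (3 * N)
  3+N≤1+3N {suc k} _ = subst (3 + suc k ≤_) (split k) (m≤m+n (3 + suc k) (k + k))
    where
    split : ∀ k → 3 + suc k + (k + k) ≡ suc (3 * suc k)
    split = solve-∀
charge⇒w≥3+N {p = suc p} {zero} _ _ o≡0⇒p≡0 _ _ = contradiction (o≡0⇒p≡0 refl) λ ()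
charge⇒w≥3+N {N} {w} {suc p} {suc o} _ _ _ fill≤N charged =
  ≤-from-budget (subst₂ _≤_ (spend N) (rearrange w (suc p) (suc o)) (s≤s charged))
    (≤-trans (+-monoʳ-≤ (suc p) (s≤s z≤n)) fill≤N) fill≤N
  where
  spend : ∀ N → 3 + 3 * N ≡ 3 + N + (N + N)
  spend = solve-∀
  rearrange : ∀ w p o → suc (w + (p + (p + o))) ≡ w + ((p + 1) + (p + o))
  rearrange = solve-∀

charge⇒w≥4+N : ∀ {N w p o} → ¬ N ≡ 2 → 1 ≤ p → 1 ≤ o → o ≤ p → p + o ≤ N →
  2 + 3 * N ≤ potential w p o → (3 + 3 * N ≤ potential w p o ⊎ 2 ≤ o ⊎ p ≤ 1) → 4 + N ≤ w
charge⇒w≥4+N {N} {w} {p} {o} N≢2 1≤p 1≤o o≤p fill≤N strong =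
  by-cases (m≤n⇒m<n∨m≡n fill≤N)
  where
  p+1≤fill : p + 1 ≤ p + o
  p+1≤fill = +-monoʳ-≤ p 1≤o
  spend : ∀ N → 4 + 3 * N ≡ 4 + N + (N + N)
  spend = solve-∀
  rearrange₁ : ∀ w p o → suc (w + (p + (p + o))) ≡ w + ((p + 1) + (p + o))
  rearrange₁ = solve-∀
  rearrange₂ : ∀ w p o → 2 + (w + (p + (p + o))) ≡ w + ((p + 1) + suc (p + o))
  rearrange₂ = solve-∀
  rearrange₂′ : ∀ w p o → 2 + (w + (p + (p + o))) ≡ w + ((p + 2) + (p + o))
  rearrange₂′ = solve-∀
  by-cases : p + o < N ⊎ p + o ≡ N →
    (3 + 3 * N ≤ potential w p o ⊎ 2 ≤ o ⊎ p ≤ 1) → 4 + N ≤ w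
  by-cases (inj₁ fill<N) _ =
    ≤-from-budget (subst₂ _≤_ (spend N) (rearrange₂ w p o) (s≤s (s≤s strong)))
      (≤-trans p+1≤fill (<⇒≤ fill<N)) fill<N
  by-cases (inj₂ _) (inj₁ slack) =
    ≤-from-budget (subst₂ _≤_ (spend N) (rearrange₁ w p o) (s≤s slack))
      (≤-trans p+1≤fill fill≤N) fill≤N
  by-cases (inj₂ _) (inj₂ (inj₁ 2≤o)) =
    ≤-from-budget (subst₂ _≤_ (spend N) (rearrange₂′ w p o) (s≤s (s≤s strong)))
      (≤-trans (+-monoʳ-≤ p 2≤o) fill≤N) fill≤N
  by-cases (inj₂ fill≡N) (inj₂ (inj₂ p≤1)) = contradiction
    (trans (sym fill≡N) (cong₂ _+_ (≤-antisym p≤1 1≤p) (≤-antisym (≤-trans o≤p p≤1) 1≤o))) N≢2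

potential-≤-when-stuck : ∀ {N M w p o} → w ≤ M + o → p + o ≤ N → M ≤ suc N →
  potential w p o ≤ suc (3 * N)
potential-≤-when-stuck {N} {M} {w} {p} {o} w≤ fill≤N M≤1+N = begin
  w + (p + (p + o))         ≤⟨ +-monoˡ-≤ (p + (p + o)) w≤ ⟩
  M + o + (p + (p + o))     ≡⟨ rearrange M p o ⟩
  M + ((p + o) + (p + o))   ≤⟨ +-mono-≤ M≤1+N (+-mono-≤ fill≤N fill≤N) ⟩
  suc N + (N + N)           ≡⟨ collect N ⟩
  suc (3 * N)               ∎
  where
  open ≤-Reasoning
  rearrange : ∀ M p o → M + o + (p + (p + o)) ≡ M + ((p + o) + (p + o))
  rearrange = solve-∀
  collect : ∀ N → suc N + (N + N) ≡ suc (3 * N)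
  collect = solve-∀

charged-strengthen : ∀ {N w p o} → ¬ p ≡ 0 → Charged N w p o → 2 + 3 * N ≤ potential w p o
charged-strengthen {p = zero}  p≢0 _       = contradiction refl p≢0
charged-strengthen {p = suc _} _   charged = charged

potential-after-fresh : ∀ {w p o w′ p′ o′} → w ≡ 2 + w′ → p′ ≡ suc p → o′ ≡ suc o →
  potential w′ p′ o′ ≡ suc (potential w p o)
potential-after-fresh {p = p} {o} {w′} refl refl refl = rearrange w′ p o
  where
  rearrange : ∀ w p o → w + (suc p + (suc p + suc o)) ≡ suc (2 + w + (p + (p + o)))
  rearrange = solve-∀

potential-after-emptying : ∀ {w p o w′ p′ o′} → w ≡ 3 + w′ → p′ ≡ suc p → o′ ≡ suc o →
  potential w′ p′ o′ ≡ potential w p o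
potential-after-emptying {p = p} {o} {w′} refl refl refl = rearrange w′ p o
  where
  rearrange : ∀ w p o → w + (suc p + (suc p + suc o)) ≡ 3 + w + (p + (p + o))
  rearrange = solve-∀

potential-after-stacking : ∀ {w p o w′ p′ o′} → w ≡ 2 + w′ → p′ ≡ suc p → o′ ≡ o →
  potential w′ p′ o′ ≡ potential w p o
potential-after-stacking {p = p} {o} {w′} refl refl refl = rearrange w′ p o
  where
  rearrange : ∀ w p o → w + (suc p + (suc p + o)) ≡ 2 + w + (p + (p + o))
  rearrange = solve-∀

fresh-target-slack : ∀ {p o p′ o′} → (o ≡ 0 → p ≡ 0) → p′ ≡ suc p → o′ ≡ suc o → 2 ≤ o′ ⊎ p′ ≤ 1
fresh-target-slack {o = zero}  o≡0⇒p≡0 refl refl = inj₂ (s≤s (≤-reflexive (o≡0⇒p≡0 refl)))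
fresh-target-slack {o = suc _} _       refl refl = inj₁ (s≤s (s≤s z≤n))

weight≤3 : ∀ {a} → a ≤ 2 → weight a ≤ 3
weight≤3 z≤n                 = z≤n
weight≤3 (s≤s z≤n)           = s≤s (s≤s z≤n)
weight≤3 (s≤s (s≤s z≤n))     = ≤-refl

weight≤2+occupied : ∀ {a} b → a ≤ 2 → ¬ (a ≡ 2 × b ≡ 0) → weight a ≤ 2 + occupied b
weight≤2+occupied b       z≤n             _     = z≤n
weight≤2+occupied b       (s≤s z≤n)       _     = m≤m+n 2 (occupied b)
weight≤2+occupied zero    (s≤s (s≤s z≤n)) ¬both = contradiction (refl , refl) ¬both
weight≤2+occupied (suc b) (s≤s (s≤s z≤n)) _     = ≤-refl

module Transfer (d : ℕ) (s : Bool) where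

  N : ℕ
  N = 3 ^ d

  source target : Config (suc d) → Config d
  source C = C ∘ (s ∷_)
  target C = C ∘ (not s ∷_)

  transfer : Config (suc d) → Vertex d → Config (suc d)
  transfer C y = move C (s ∷ y) (not s ∷ y)

  sourceWeight targetPebbles targetOccupied targetFill Φ : Config (suc d) → ℕ
  sourceWeight   C = totalWeight (source C)
  targetPebbles  C = pebbleCount (target C)
  targetOccupied C = occupiedCount (target C)
  targetFill     C = targetPebbles C + targetOccupied C
  Φ              C = potential (sourceWeight C) (targetPebbles C) (targetOccupied C)

  ∑-source-transfer : ∀ (f : ℕ → ℕ) C y →
    ∑ (f ∘ source (transfer C y)) + f (source C y) ≡ ∑ (f ∘ source C) + f (source C y ∸ 2)
  ∑-source-transfer f C y =
    trans (cong (_+ f (source C y)) (∑-cong (cong f ∘ move-across-source s C y)))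
          (∑-update f (source C) y (source C y ∸ 2))

  ∑-target-transfer : ∀ (f : ℕ → ℕ) C y →
    ∑ (f ∘ target (transfer C y)) + f (target C y) ≡ ∑ (f ∘ target C) + f (suc (target C y))
  ∑-target-transfer f C y =
    trans (cong (_+ f (target C y)) (∑-cong (cong f ∘ move-across-target s C y)))
          (∑-update f (target C) y (suc (target C y)))

  targetPebbles-transfer : ∀ C y → targetPebbles (transfer C y) ≡ suc (targetPebbles C)
  targetPebbles-transfer C y =
    +-cancelʳ-≡ (target C y) _ _ (trans (∑-target-transfer id C y) (+-suc _ _))

  targetOccupied-transfer-empty : ∀ C y → target C y ≡ 0 →
    targetOccupied (transfer C y) ≡ suc (targetOccupied C)
  targetOccupied-transfer-empty C y empty = begin
    o′                            ≡⟨ sym (+-identityʳ o′) ⟩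
    o′ + occupied 0               ≡⟨ cong (λ b → o′ + occupied b) (sym empty) ⟩
    o′ + occupied (target C y)    ≡⟨ ∑-target-transfer occupied C y ⟩
    targetOccupied C + 1          ≡⟨ +-comm _ 1 ⟩
    suc (targetOccupied C)        ∎
    where
    open ≡-Reasoning
    o′ = targetOccupied (transfer C y)

  targetOccupied-transfer-occupied : ∀ C y → 1 ≤ target C y →
    targetOccupied (transfer C y) ≡ targetOccupied C
  targetOccupied-transfer-occupied C y 1≤b with target C y | ∑-target-transfer occupied C y
  ... | suc _ | balance = +-cancelʳ-≡ 1 _ _ balance

  sourceWeight-transfer : ∀ C y → 3 ≤ source C y → sourceWeight C ≡ 2 + sourceWeight (transfer C y)
  sourceWeight-transfer C y 3≤a = +-cancelʳ-≡ (weight (a ∸ 2)) _ _ (begin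
    sourceWeight C + weight (a ∸ 2)   ≡⟨ sym (∑-source-transfer weight C y) ⟩
    w′ + weight a                     ≡⟨ cong (w′ +_) (weight-∸2 3≤a) ⟩
    w′ + (2 + weight (a ∸ 2))         ≡⟨ +-suc w′ _ ⟩
    suc (w′ + suc (weight (a ∸ 2)))   ≡⟨ cong suc (+-suc w′ _) ⟩
    2 + w′ + weight (a ∸ 2)           ∎)
    where
    open ≡-Reasoning
    a  = source C y
    w′ = sourceWeight (transfer C y)

  sourceWeight-transfer-2 : ∀ C y → source C y ≡ 2 →
    sourceWeight C ≡ 3 + sourceWeight (transfer C y)
  sourceWeight-transfer-2 C y a≡2 with source C y | ∑-source-transfer weight C y
  ... | 2 | balance = trans (sym (+-identityʳ _)) (trans (sym balance) (+-comm _ 3))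

  source-transfer-elsewhere : ∀ C {x y} → ¬ x ≡ y → source (transfer C y) x ≡ source C x
  source-transfer-elsewhere C {x} {y} x≢y =
    trans (move-across-source s C y x) (update-≢ (source C) _ x≢y)

  target-transfer-elsewhere : ∀ C {x y} → ¬ x ≡ y → target (transfer C y) x ≡ target C x
  target-transfer-elsewhere C {x} {y} x≢y =
    trans (move-across-target s C y x) (update-≢ (target C) _ x≢y)

  target-transfer-here : ∀ C y → target (transfer C y) y ≡ suc (target C y)
  target-transfer-here C y = trans (move-across-target s C y y) (update-≡ (target C) y _)

  targetOccupied≤targetPebbles : ∀ C → targetOccupied C ≤ targetPebbles C
  targetOccupied≤targetPebbles C = occupiedCount≤pebbleCount (target C)

  targetOccupied≡0⇒targetPebbles≡0 : ∀ C → targetOccupied C ≡ 0 → targetPebbles C ≡ 0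
  targetOccupied≡0⇒targetPebbles≡0 C = occupiedCount≡0⇒pebbleCount≡0 (target C)

  IsCharged : Config (suc d) → Set
  IsCharged C = Charged N (sourceWeight C) (targetPebbles C) (targetOccupied C)

  -- A push at y changes (w, p, o) by (−2, +1, +1) when fresh, (−3, +1, +1) when emptying and
  -- (−2, +1, 0) when stacking (3 ≤ source C y, target C y ≠ 0); the fourth kind is never made.
  FreshMove EmptyingMove : Config (suc d) → Vertex d → Set
  FreshMove    C y = 3 ≤ source C y × target C y ≡ 0
  EmptyingMove C y = source C y ≡ 2 × target C y ≡ 0

  NoEmptyingMove : Config (suc d) → Set
  NoEmptyingMove C = ∀ y → ¬ EmptyingMove C y

  sourceWeight-≥3+N : ∀ C → targetFill C ≤ N → IsCharged C → 3 + N ≤ sourceWeight C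
  sourceWeight-≥3+N C =
    charge⇒w≥3+N {N} {sourceWeight C} (1≤3^d d)
      (targetOccupied≤targetPebbles C) (targetOccupied≡0⇒targetPebbles≡0 C)

  -- Spare charge that the final emptying move, the costliest one, may need.
  Slack : Config (suc d) → Set
  Slack C = 3 + 3 * N ≤ Φ C ⊎ 2 ≤ targetOccupied C ⊎ NoEmptyingMove C ⊎ targetPebbles C ≤ 1

  slack-after-fresh-target : ∀ C y → target C y ≡ 0 → Slack (transfer C y)
  slack-after-fresh-target C y empty =
    [ inj₂ ∘ inj₁ , inj₂ ∘ inj₂ ∘ inj₂ ]′
      (fresh-target-slack (targetOccupied≡0⇒targetPebbles≡0 C)
        (targetPebbles-transfer C y) (targetOccupied-transfer-empty C y empty))

  record Progress (C : Config (suc d)) : Set where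
    field
      vertex             : Vertex d
      enough-pebbles     : 2 ≤ source C vertex
      fill-grows         : suc (targetFill C) ≤ targetFill (transfer C vertex)
      source-stays-heavy : suc N ≤ sourceWeight (transfer C vertex)
      potential-high     : 2 + 3 * N ≤ Φ (transfer C vertex)
      slack-kept         : Slack (transfer C vertex)

  fresh-progress : ∀ C y → FreshMove C y → targetFill C ≤ N → IsCharged C → Progress C
  fresh-progress C y (3≤a , empty) fill≤N charged = record
    { vertex             = y
    ; enough-pebbles     = ≤-trans (n≤1+n 2) 3≤a
    ; fill-grows         = subst (suc (targetFill C) ≤_) (sym (cong₂ _+_ p′≡ o′≡))
                             (s≤s (+-monoʳ-≤ (targetPebbles C) (n≤1+n _)))
    ; source-stays-heavy = s≤s⁻¹ (s≤s⁻¹ (subst (3 + N ≤_) w≡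
                             (sourceWeight-≥3+N C fill≤N charged)))
    ; potential-high     = subst (2 + 3 * N ≤_) (sym (potential-after-fresh w≡ p′≡ o′≡))
                             (s≤s (charged-weaken {N} {sourceWeight C} charged))
    ; slack-kept         = slack-after-fresh-target C y empty
    }
    where
    w≡  = sourceWeight-transfer C y 3≤a
    p′≡ = targetPebbles-transfer C y
    o′≡ = targetOccupied-transfer-empty C y empty

  emptying-progress : ∀ C y → EmptyingMove C y → targetFill C ≤ N → ¬ targetPebbles C ≡ 0 →
    2 + 3 * N ≤ Φ C → Slack C → Progress C
  emptying-progress C y (a≡2 , empty) fill≤N p≢0 strong slack = record
    { vertex             = y
    ; enough-pebbles     = ≤-reflexive (sym a≡2)
    ; fill-grows         = subst (suc (targetFill C) ≤_) (sym (cong₂ _+_ p′≡ o′≡))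
                             (s≤s (+-monoʳ-≤ (targetPebbles C) (n≤1+n _)))
    ; source-stays-heavy = s≤s⁻¹ (s≤s⁻¹ (s≤s⁻¹ (subst (4 + N ≤_) w≡
                             (charge⇒w≥4+N {N} {sourceWeight C} (3^d≢2 d) (n≢0⇒n>0 p≢0) 1≤o
                               (targetOccupied≤targetPebbles C) fill≤N strong (slack′ slack)))))
    ; potential-high     = subst (2 + 3 * N ≤_) (sym (potential-after-emptying w≡ p′≡ o′≡)) strong
    ; slack-kept         = slack-after-fresh-target C y empty
    }
    where
    w≡  = sourceWeight-transfer-2 C y a≡2
    p′≡ = targetPebbles-transfer C y
    o′≡ = targetOccupied-transfer-empty C y empty
    1≤o : 1 ≤ targetOccupied C
    1≤o = n≢0⇒n>0 (p≢0 ∘ targetOccupied≡0⇒targetPebbles≡0 C)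
    slack′ : Slack C → 3 + 3 * N ≤ Φ C ⊎ 2 ≤ targetOccupied C ⊎ targetPebbles C ≤ 1
    slack′ (inj₁ high)               = inj₁ high
    slack′ (inj₂ (inj₁ 2≤o))         = inj₂ (inj₁ 2≤o)
    slack′ (inj₂ (inj₂ (inj₁ none))) = contradiction (a≡2 , empty) (none y)
    slack′ (inj₂ (inj₂ (inj₂ p≤1)))  = inj₂ (inj₂ p≤1)

  no-emptying-after-stacking : ∀ C y → NoEmptyingMove C → NoEmptyingMove (transfer C y)
  no-emptying-after-stacking C y none x = by-cases (x ≟V y)
    where
    by-cases : Dec (x ≡ y) → ¬ EmptyingMove (transfer C y) x
    by-cases (yes refl) (_ , b′≡0)    = 1+n≢0 (trans (sym (target-transfer-here C y)) b′≡0)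
    by-cases (no x≢y)   (a′≡2 , b′≡0) = none x ( trans (sym (source-transfer-elsewhere C x≢y)) a′≡2
                                               , trans (sym (target-transfer-elsewhere C x≢y)) b′≡0)

  stacking-progress : ∀ C y → 3 ≤ source C y → 1 ≤ target C y → targetFill C ≤ N →
    2 + 3 * N ≤ Φ C → NoEmptyingMove C → Progress C
  stacking-progress C y 3≤a 1≤b fill≤N strong none = record
    { vertex             = y
    ; enough-pebbles     = ≤-trans (n≤1+n 2) 3≤a
    ; fill-grows         = ≤-reflexive (sym (cong₂ _+_ p′≡ o′≡))
    ; source-stays-heavy = s≤s⁻¹ (s≤s⁻¹ (subst (3 + N ≤_) w≡
                             (sourceWeight-≥3+N C fill≤N
                               (charged-from-strong {N} {sourceWeight C} strong))))
    ; potential-high     = subst (2 + 3 * N ≤_) (sym (potential-after-stacking w≡ p′≡ o′≡)) strong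
    ; slack-kept         = inj₂ (inj₂ (inj₁ (no-emptying-after-stacking C y none)))
    }
    where
    w≡  = sourceWeight-transfer C y 3≤a
    p′≡ = targetPebbles-transfer C y
    o′≡ = targetOccupied-transfer-occupied C y 1≤b

  uncharged-without-fresh-move : ∀ C → targetPebbles C ≡ 0 → (∀ y → ¬ FreshMove C y) → ¬ IsCharged C
  uncharged-without-fresh-move C p≡0 noFresh charged =
    1+n≰n (≤-trans (charged-weaken {N} {sourceWeight C} charged) (begin
      Φ C                  ≡⟨ cong₂ (potential (sourceWeight C)) p≡0 o≡0 ⟩
      sourceWeight C + 0   ≡⟨ +-identityʳ _ ⟩
      sourceWeight C       ≤⟨ ∑-mono-≤ (weight≤3 ∘ source≤2) ⟩
      ∑ {d} (λ _ → 3)      ≡⟨ ∑-const d 3 ⟩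
      3 * 2 ^ d            ≤⟨ *-monoʳ-≤ 3 (2^d≤3^d d) ⟩
      3 * N                ∎))
    where
    open ≤-Reasoning
    o≡0 : targetOccupied C ≡ 0
    o≡0 = n≤0⇒n≡0 (subst (targetOccupied C ≤_) p≡0 (targetOccupied≤targetPebbles C))
    source≤2 : ∀ y → source C y ≤ 2
    source≤2 y = ≮⇒≥ λ 3≤a → noFresh y (3≤a , ∑≡0⇒≡0 (target C) p≡0 y)

  potential-low-when-stuck : ∀ C → targetFill C ≤ N → NoEmptyingMove C →
    (∀ y → ¬ 3 ≤ source C y) → ¬ 2 + 3 * N ≤ Φ C
  potential-low-when-stuck C fill≤N noEmptying noStacking strong =
    1+n≰n (≤-trans strong (potential-≤-when-stuck w≤ fill≤N (2^[1+d]≤1+3^d d)))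
    where
    w≤ : sourceWeight C ≤ 2 * 2 ^ d + targetOccupied C
    w≤ = begin
      sourceWeight C                                ≤⟨ ∑-mono-≤ (λ y → weight≤2+occupied (target C y)
                                                         (≮⇒≥ (noStacking y)) (noEmptying y)) ⟩
      ∑ (λ y → 2 + occupied (target C y))          ≡⟨ ∑-distrib-+ (λ _ → 2) (occupied ∘ target C) ⟩
      ∑ {d} (λ _ → 2) + targetOccupied C           ≡⟨ cong (_+ targetOccupied C) (∑-const d 2) ⟩
      2 * 2 ^ d + targetOccupied C                 ∎
      where open ≤-Reasoning

  progress-without-fresh-move : ∀ C → targetFill C ≤ N → (∀ y → ¬ FreshMove C y) →
    ¬ targetPebbles C ≡ 0 → 2 + 3 * N ≤ Φ C → Slack C → Progress C
  progress-without-fresh-move C fill≤N noFresh p≢0 strong slack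
    with search (EmptyingMove C) (λ y → source C y ≟ 2 ×-dec target C y ≟ 0)
       | search (λ y → 3 ≤ source C y) (λ y → 3 ≤? source C y)
  ... | inj₁ (y , emptying) | _ = emptying-progress C y emptying fill≤N p≢0 strong slack
  ... | inj₂ noEmptying | inj₁ (y , 3≤a) =
    stacking-progress C y 3≤a (n≢0⇒n>0 λ empty → noFresh y (3≤a , empty)) fill≤N strong noEmptying
  ... | inj₂ noEmptying | inj₂ noStacking =
    contradiction strong (potential-low-when-stuck C fill≤N noEmptying noStacking)

  -- Emptying moves take precedence over stacking moves: a stacking move is only made when no
  -- emptying move exists, and that is what keeps Slack alive.
  make-progress : ∀ C → targetFill C ≤ N → IsCharged C → Slack C → Progress C
  make-progress C fill≤N charged slack
    with search (FreshMove C) (λ y → 3 ≤? source C y ×-dec target C y ≟ 0)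
  ... | inj₁ (y , fresh) = fresh-progress C y fresh fill≤N charged
  ... | inj₂ noFresh with targetPebbles C ≟ 0
  ...   | yes p≡0 = contradiction charged (uncharged-without-fresh-move C p≡0 noFresh)
  ...   | no p≢0  = progress-without-fresh-move C fill≤N noFresh p≢0
                      (charged-strengthen {N} {sourceWeight C} p≢0 charged) slack

  module _ (coverable-above : ∀ (D : Config d) → suc N ≤ totalWeight D → Coverable D) where

    coverable-when-balanced : ∀ C → suc N ≤ sourceWeight C → suc N ≤ targetFill C → Coverable C
    coverable-when-balanced C heavy-source heavy-target = coverable-from-halves s C
      (coverable-above (source C) heavy-source)
      (coverable-above (target C)
        (subst (suc N ≤_) (sym (totalWeight≡pebbles+occupied (target C))) heavy-target))

    transfer-loop : ∀ fuel C → suc N ≤ fuel + targetFill C → targetFill C ≤ N →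
      IsCharged C → Slack C → Coverable C
    transfer-loop zero       C enough fill≤N _ _ = contradiction (≤-trans enough fill≤N) 1+n≰n
    transfer-loop (suc fuel) C enough fill≤N charged slack =
      step (s ∷ vertex) (not s ∷ vertex) (adjacent-across s vertex) enough-pebbles continue
      where
      open Progress (make-progress C fill≤N charged slack)
      C′ = transfer C vertex
      continue : Coverable C′
      continue with suc N ≤? targetFill C′
      ... | yes full    = coverable-when-balanced C′ source-stays-heavy full
      ... | no notFull  = transfer-loop fuel C′
              (≤-trans enough (subst (_≤ fuel + targetFill C′) (+-suc fuel _)
                                     (+-monoʳ-≤ fuel fill-grows)))
              (≮⇒≥ notFull) (charged-from-strong {N} {sourceWeight C′} potential-high) slack-kept

    coverable-when-target-light : ∀ C → suc (3 * N) ≤ sourceWeight C + totalWeight (target C) →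
      totalWeight (target C) ≤ N → Coverable C
    coverable-when-target-light C heavy light =
      transfer-loop (suc N) C (s≤s (m≤m+n N _)) fill≤N charged
        ([ inj₁ , inj₂ ∘ inj₂ ∘ inj₂ ]′ slack)
      where
      total≡fill = totalWeight≡pebbles+occupied (target C)
      fill≤N = subst (_≤ N) total≡fill light
      initially = initially-charged {N} {sourceWeight C}
                    (subst (λ t → suc (3 * N) ≤ sourceWeight C + t) total≡fill heavy)
      charged = proj₁ initially
      slack   = proj₂ initially

coverable-if-heavy-step : ∀ d → (∀ (D : Config d) → suc (3 ^ d) ≤ totalWeight D → Coverable D) →
  ∀ (C : Config (suc d)) → suc (3 ^ suc d) ≤ totalWeight C → Coverable C
coverable-if-heavy-step d coverable-above C heavy
  with suc (3 ^ d) ≤? totalWeight (C ∘ (false ∷_)) | suc (3 ^ d) ≤? totalWeight (C ∘ (true ∷_))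
... | yes heavy₀ | yes heavy₁ =
  coverable-from-halves false C (coverable-above _ heavy₀) (coverable-above _ heavy₁)
... | _          | no light₁  =
  Transfer.coverable-when-target-light d false coverable-above C heavy (≮⇒≥ light₁)
... | no light₀  | yes _      =
  Transfer.coverable-when-target-light d true coverable-above C
    (subst (suc (3 ^ suc d) ≤_) (+-comm (totalWeight (C ∘ (false ∷_))) _) heavy) (≮⇒≥ light₀)

coverable-if-heavy : ∀ d (C : Config d) → suc (3 ^ d) ≤ totalWeight C → Coverable C
coverable-if-heavy zero    C heavy = covered λ { [] → positive heavy }
  where
  positive : ∀ {n} → 2 ≤ weight n → 0 < n
  positive {suc _} _ = s≤s z≤n
coverable-if-heavy (suc d) C heavy = coverable-if-heavy-step d (coverable-if-heavy d) C heavy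

-- The bound holds for d = 0 as well.
theorem3 : (d : ℕ) → 1 ≤ d → (C : Config d) →
    3 ^ d + 1 ≤ size C + supportSize C → Coverable C
theorem3 d _ C h =
  coverable-if-heavy d C (subst₂ _≤_ (+-comm (3 ^ d) 1) (size+supportSize≡totalWeight C) h)
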